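{- Let $D_1,D_2$ be $(2^n,2^n,2^n,1)$-relative difference sets in $\mathbb{Z}_4^n$ relative to $2\mathbb{Z}_4^n$ whose $\mathbb{F}_2^n$-representations $h_1,h_2:\mathbb{F}_2^n\to\mathbb{F}_2^n$ are normalized. Let $M:\mathbb{F}_2^n\to\mathbb{F}_2^n$ be an invertible $\mathbb{F}_2$-linear map. Then there exists a matrix $L\in M_{n\times n}(\mathbb{Z}/4\mathbb{Z})$ whose reduction modulo $2$ is the matrix of $M$ (i.e. $(L\bmod 2)x^T=M(x)$ for all $x$) such that $D_2=\rho(L)(D_1)$, if and only if $$M(x)*_{h_2}M(y)=M(x*_{h_1}y)\quad\text{for all }x,y\in\mathbb{F}_2^n.$$
   Context: A $k$-subset $D$ of a group $G$ of order $mn$ with subgroup $N$ of order $n$ is an $(m,n,k,\lambda)$-relative difference set relative to $N$ if every element of $G\setminus N$ is represented exactly $\lambda$ times as a difference of elements of $D$ and no nonzero element of $N$ is. Let $\psi:\mathbb{F}_2\to\mathbb{Z}_4$ be $0\mapsto0$, $1\mapsto1$, $\Psi$ its coordinatewise extension $\mathbb{F}_2^n\to\mathbb{Z}_4^n$, and write $\lfloor a,b\rfloor:=\Psi(a)+2\Psi(b)$ ($a,b\in\mathbb{F}_2^n$); every element of $\mathbb{Z}_4^n$ has a unique such form. Such a relative difference set $D$ is a transversal of $2\mathbb{Z}_4^n$, so its elements are uniquely $\lfloor d,h(d)\rfloor$ for a map $h:\mathbb{F}_2^n\to\mathbb{F}_2^n$ (the $\mathbb{F}_2^n$-representation of $D$);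 $h$ is normalized if no coordinate function of $h$ (written as a reduced polynomial in $x_0,\dots,x_{n-1}$ over $\mathbb{F}_2$) has a linear or constant term. For $x,y\in\mathbb{F}_2^n$, $x\odot y=(x_0y_0,\dots,x_{n-1}y_{n-1})$ and $x*_hy:=h(x+y)+h(x)+h(y)+x\odot y$. For $L\in M_{n\times n}(\mathbb{Z}/4\mathbb{Z})$, $\rho(L)$ is the endomorphism $v\mapsto Lv^T$ of $\mathbb{Z}_4^n$. -}

module Defs where

open import Data.Nat as ℕ using (ℕ; _^_)
open import Data.Nat.DivMod using (_mod_; _%_)
open import Data.Fin as Fin using (Fin; toℕ)
open import Data.Fin.Properties using () renaming (_≟_ to _≟F_)
open import Data.Bool using (Bool; true; false; _xor_; _∧_; if_then_else_)
open import Data.Vec using (Vec; []; _∷_; zipWith; map; replicate; lookup; tabulate; foldr)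
open import Data.Vec.Properties using (≡-dec)
open import Data.List as List using (List; cartesianProduct; filter; length)
open import Data.List.Membership.Propositional using (_∈_)
open import Data.List.Relation.Unary.Unique.Propositional using (Unique)
open import Data.Product using (Σ; _×_; _,_; proj₁; proj₂; ∃; ∃-syntax)
open import Relation.Binary.PropositionalEquality using (_≡_; _≢_)
open import Relation.Nullary using (¬_; does)
open import Function.Bundles using (_⇔_)

ℤ₄ : Set
ℤ₄ = Fin 4

_+₄_ : ℤ₄ → ℤ₄ → ℤ₄
a +₄ b = (toℕ a ℕ.+ toℕ b) mod 4

_*₄_ : ℤ₄ → ℤ₄ → ℤ₄
a *₄ b = (toℕ a ℕ.* toℕ b) mod 4

-₄_ : ℤ₄ → ℤ₄
-₄ a = (4 ℕ.∸ toℕ a) mod 4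

Z4V : ℕ → Set
Z4V n = Vec ℤ₄ n

F2V : ℕ → Set
F2V n = Vec Bool n

infixl 6 _+ᶻ_ _-ᶻ_
_+ᶻ_ : ∀ {n} → Z4V n → Z4V n → Z4V n
_+ᶻ_ = zipWith _+₄_

_-ᶻ_ : ∀ {n} → Z4V n → Z4V n → Z4V n
u -ᶻ v = zipWith _+₄_ u (map -₄_ v)

0ᶻ : ∀ {n} → Z4V n
0ᶻ = replicate _ Fin.zero

_≟ᶻ_ : ∀ {n} (u v : Z4V n) → Relation.Nullary.Dec (u ≡ v)
_≟ᶻ_ = ≡-dec _≟F_

infixl 6 _⊕_
infixl 7 _⊙_
_⊕_ : ∀ {n} → F2V n → F2V n → F2V n
_⊕_ = zipWith _xor_

_⊙_ : ∀ {n} → F2V n → F2V n → F2V n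
_⊙_ = zipWith _∧_

0ᶠ : ∀ {n} → F2V n
0ᶠ = replicate _ false

eᶠ : ∀ {n} → Fin n → F2V n
eᶠ i = tabulate (λ k → does (k ≟F i))

ψ : Bool → ℤ₄
ψ false = Fin.zero
ψ true  = Fin.suc Fin.zero

Ψ : ∀ {n} → F2V n → Z4V n
Ψ = map ψ

two : ℤ₄
two = Fin.suc (Fin.suc Fin.zero)

⌊_,_⌋ : ∀ {n} → F2V n → F2V n → Z4V n
⌊ a , b ⌋ = Ψ a +ᶻ map (two *₄_) (Ψ b)

In2Z4 : ∀ {n} → Z4V n → Set
In2Z4 {n} v = ∃[ b ] v ≡ ⌊ replicate n false , b ⌋

diffCount : ∀ {n} → List (Z4V n) → Z4V n → ℕ
diffCount D g =
  length (filter (λ p → (proj₁ p -ᶻ proj₂ p) ≟ᶻ g) (cartesianProduct D D))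

record IsRDS {n : ℕ} (N : Z4V n → Set) (k λ′ : ℕ) (D : List (Z4V n)) : Set where
  field
    unique   : Unique D
    size     : length D ≡ k
    outsideN : ∀ g → ¬ N g → diffCount D g ≡ λ′
    insideN  : ∀ g → N g → g ≢ 0ᶻ → diffCount D g ≡ 0

IsRDS4 : (n : ℕ) → List (Z4V n) → Set
IsRDS4 n D = IsRDS (In2Z4 {n}) (2 ^ n) 1 D

IsRepresentation : ∀ {n} → List (Z4V n) → (F2V n → F2V n) → Set
IsRepresentation {n} D h = ∀ v → (v ∈ D) ⇔ (∃[ d ] v ≡ ⌊ d , h d ⌋)

-- For f : 𝔽₂ⁿ → 𝔽₂ with algebraic normal form
-- f = Σ_S a_S x^S, the Möbius-inversion formula a_S = Σ_{T⊆S} f(1_T)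
-- gives  a_∅ = f(0)  (constant term) and  a_{i} = f(0) + f(eᵢ)
-- (coefficient of the linear term xᵢ).

constCoeff : ∀ {n} → (F2V n → Bool) → Bool
constCoeff f = f 0ᶠ

linCoeff : ∀ {n} → (F2V n → Bool) → Fin n → Bool
linCoeff f i = f 0ᶠ xor f (eᶠ i)

coord : ∀ {n} → (F2V n → F2V n) → Fin n → F2V n → Bool
coord h i x = lookup (h x) i

Normalized : ∀ {n} → (F2V n → F2V n) → Set
Normalized {n} h =
  ∀ (i : Fin n) → constCoeff (coord h i) ≡ false
                × (∀ (j : Fin n) → linCoeff (coord h i) j ≡ false)

star : ∀ {n} → (F2V n → F2V n) → F2V n → F2V n → F2V n
star h x y = h (x ⊕ y) ⊕ h x ⊕ h y ⊕ (x ⊙ y)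

IsF2Linear : ∀ {n} → (F2V n → F2V n) → Set
IsF2Linear M = ∀ x y → M (x ⊕ y) ≡ M x ⊕ M y

IsInvertible : ∀ {n} → (F2V n → F2V n) → Set
IsInvertible {n} M =
  Σ (F2V n → F2V n) λ M′ →
    (∀ (x : F2V n) → M′ (M x) ≡ x) × (∀ (x : F2V n) → M (M′ x) ≡ x)

-- n×n matrices over ℤ/4ℤ, as a vector of rows
Mat4 : ℕ → Set
Mat4 n = Vec (Vec ℤ₄ n) n

ρ : ∀ {n} → Mat4 n → Z4V n → Z4V n
ρ L v = map (λ row → foldr (λ _ → ℤ₄) _+₄_ Fin.zero (zipWith _*₄_ row v)) L

mod2 : ℤ₄ → Bool
mod2 a = does ((toℕ a % 2) Data.Nat.≟ 1)
  where import Data.Nat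

applyMod2 : ∀ {n} → Mat4 n → F2V n → F2V n
applyMod2 L x =
  map (λ row → foldr (λ _ → Bool) _xor_ false (zipWith _∧_ (map mod2 row) x)) L

SameSet : ∀ {n} → List (Z4V n) → List (Z4V n) → Set
SameSet {n} A B = ∀ (v : Z4V n) → (v ∈ A) ⇔ (v ∈ B)

-- For a matrix L over ℤ/4 with reduction L̄ mod 2, write ρ(L)(Ψ a) = ⌊ L̄ a , q_L a ⌋ (q_L is ρΨ-high
-- L).  Since ⌊ a , b ⌋ = Ψ a + 2 Ψ b, ρ(L) sends ⌊ d , h₁ d ⌋ to ⌊ L̄ d , q_L d ⊕ L̄ (h₁ d) ⌋; so for
-- a lift L of M, ρ(L) D₁ = D₂ exactly when q_L equals g d = h₂ (M d) ⊕ M (h₁ d) (the map mismatch).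
-- Evaluating ρ(L) on Ψ x + Ψ y in two ways shows that the polarization Δ q_L (x , y) = q_L (x ⊕ y) ⊕
-- q_L x ⊕ q_L y is M x ⊙ M y ⊕ M (x ⊙ y), while M x *_{h₂} M y = M (x *_{h₁} y) says precisely that Δ
-- g has the same value.  Conversely, the lift L with columns ⌊ M eᵢ , g eᵢ ⌋ has q_L = g on the basis,
-- and two maps with the same polarization that agree on the basis differ by an additive map vanishing
-- on the basis.
module Submission where

open import Defs
open import Data.Nat using (ℕ; zero; suc)
open import Data.Bool using (Bool; true; false; _xor_; _∧_)
open import Data.Bool.Properties as B using (xor-assoc; xor-comm; xor-identityˡ; xor-identityʳ; xor-same)
open import Data.Fin as Fin using (Fin)
open import Data.Fin.Properties as F using (all?)
open import Data.List using (List; map)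
open import Data.List.Membership.Propositional using (_∈_)
open import Data.List.Membership.Propositional.Properties using (∈-map⁺; ∈-map⁻)
open import Data.Product using (_×_; _,_; proj₁; proj₂; ∃-syntax)
open import Data.Unit using (tt)
open import Data.Vec as V using (Vec; _∷_; []; tabulate; lookup)
open import Data.Vec.Properties
  using (zipWith-assoc; zipWith-comm; zipWith-identityˡ; zipWith-identityʳ; tabulate-allFin; map-const;
         map-∘; map-cong; tabulate-∘; tabulate-cong; tabulate∘lookup)
open import Function using (_∘_)
open import Function.Bundles using (_⇔_; mk⇔; Equivalence)
open import Function.Properties.Equivalence using () renaming (refl to ⇔-refl; trans to ⇔-trans)
open import Relation.Binary.PropositionalEquality
  using (_≡_; _≗_; refl; sym; trans; cong; cong₂; subst; module ≡-Reasoning)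
open import Relation.Nullary using (Dec)
open import Relation.Nullary.Decidable using (map′; _×-dec_; toWitness)

open Equivalence

≡-resp-⇔ : ∀ {A : Set} {a a′ b b′ : A} → a ≡ a′ → b ≡ b′ → (a ≡ b) ⇔ (a′ ≡ b′)
≡-resp-⇔ refl refl = ⇔-refl

⊕-assoc : ∀ {n} (x y z : F2V n) → x ⊕ y ⊕ z ≡ x ⊕ (y ⊕ z)
⊕-assoc = zipWith-assoc xor-assoc

⊕-comm : ∀ {n} (x y : F2V n) → x ⊕ y ≡ y ⊕ x
⊕-comm = zipWith-comm xor-comm

⊕-identityˡ : ∀ {n} (x : F2V n) → 0ᶠ ⊕ x ≡ x
⊕-identityˡ = zipWith-identityˡ xor-identityˡ

⊕-identityʳ : ∀ {n} (x : F2V n) → x ⊕ 0ᶠ ≡ x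
⊕-identityʳ = zipWith-identityʳ xor-identityʳ

⊕-same : ∀ {n} (x : F2V n) → x ⊕ x ≡ 0ᶠ
⊕-same []      = refl
⊕-same (a ∷ x) = cong₂ _∷_ (xor-same a) (⊕-same x)

⊕-involutiveʳ : ∀ {n} (x y : F2V n) → x ⊕ y ⊕ y ≡ x
⊕-involutiveʳ x y = trans (⊕-assoc x y y) (trans (cong (x ⊕_) (⊕-same y)) (⊕-identityʳ x))

⊕-interchange : ∀ {n} (a b c d : F2V n) → (a ⊕ b) ⊕ (c ⊕ d) ≡ (a ⊕ c) ⊕ (b ⊕ d)
⊕-interchange a b c d = begin
  (a ⊕ b) ⊕ (c ⊕ d)   ≡⟨ ⊕-assoc a b (c ⊕ d) ⟩
  a ⊕ (b ⊕ (c ⊕ d))   ≡⟨ cong (a ⊕_) (sym (⊕-assoc b c d)) ⟩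
  a ⊕ (b ⊕ c ⊕ d)     ≡⟨ cong (λ z → a ⊕ (z ⊕ d)) (⊕-comm b c) ⟩
  a ⊕ (c ⊕ b ⊕ d)     ≡⟨ cong (a ⊕_) (⊕-assoc c b d) ⟩
  a ⊕ (c ⊕ (b ⊕ d))   ≡⟨ sym (⊕-assoc a c (b ⊕ d)) ⟩
  (a ⊕ c) ⊕ (b ⊕ d)   ∎
  where open ≡-Reasoning

⊕-transpose : ∀ {n} {x c y : F2V n} → (x ⊕ c ≡ y) ⇔ (x ≡ y ⊕ c)
⊕-transpose {x = x} {c} {y} = mk⇔
  (λ x⊕c≡y → trans (sym (⊕-involutiveʳ x c)) (cong (_⊕ c) x⊕c≡y))
  (λ x≡y⊕c → trans (cong (_⊕ c) x≡y⊕c) (⊕-involutiveʳ y c))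

⊕≡0ᶠ⇔≡ : ∀ {n} {x y : F2V n} → (x ⊕ y ≡ 0ᶠ) ⇔ (x ≡ y)
⊕≡0ᶠ⇔≡ {y = y} = ⇔-trans ⊕-transpose (≡-resp-⇔ refl (⊕-identityˡ y))

⊕-swap-≡ : ∀ {n} {a b c d : F2V n} → (a ⊕ b ≡ c ⊕ d) ⇔ (a ⊕ c ≡ b ⊕ d)
⊕-swap-≡ = mk⇔ swap swap
  where
  swap : ∀ {n} {a b c d : F2V n} → a ⊕ b ≡ c ⊕ d → a ⊕ c ≡ b ⊕ d
  swap {a = a} {b} {c} {d} e = to ⊕≡0ᶠ⇔≡ (trans (⊕-interchange a c b d) (from ⊕≡0ᶠ⇔≡ e))

Additive : ∀ {n m} → (F2V n → F2V m) → Set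
Additive f = ∀ x y → f (x ⊕ y) ≡ f x ⊕ f y

Δ : ∀ {n m} → (F2V n → F2V m) → F2V n → F2V n → F2V m
Δ f x y = f (x ⊕ y) ⊕ f x ⊕ f y

Δ-cong : ∀ {n m} {f g : F2V n → F2V m} → f ≗ g → ∀ x y → Δ f x y ≡ Δ g x y
Δ-cong f≗g x y = cong₂ _⊕_ (cong₂ _⊕_ (f≗g (x ⊕ y)) (f≗g x)) (f≗g y)

Δ≡0ᶠ⇔additive : ∀ {n m} (f : F2V n → F2V m) (x y : F2V n) →
  (Δ f x y ≡ 0ᶠ) ⇔ (f (x ⊕ y) ≡ f x ⊕ f y)
Δ≡0ᶠ⇔additive f x y = mk⇔
  (λ e → to ⊕≡0ᶠ⇔≡ (trans (sym (⊕-assoc (f (x ⊕ y)) (f x) (f y))) e))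
  (λ e → trans (⊕-assoc (f (x ⊕ y)) (f x) (f y)) (from ⊕≡0ᶠ⇔≡ e))

Δ-⊕ : ∀ {n m} (f g : F2V n → F2V m) (x y : F2V n) → Δ (λ z → f z ⊕ g z) x y ≡ Δ f x y ⊕ Δ g x y
Δ-⊕ f g x y = trans (cong (_⊕ (f y ⊕ g y)) (⊕-interchange (f (x ⊕ y)) (g (x ⊕ y)) (f x) (g x)))
                    (⊕-interchange (f (x ⊕ y) ⊕ f x) (g (x ⊕ y) ⊕ g x) (f y) (g y))

Δ-∘-additive : ∀ {n m} (M : F2V m → F2V m) → Additive M → (f : F2V n → F2V m) (x y : F2V n) →
  M (Δ f x y) ≡ Δ (M ∘ f) x y
Δ-∘-additive M M-additive f x y = trans (M-additive _ _) (cong (_⊕ M (f y)) (M-additive _ _))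

tabulate-false : ∀ n → tabulate {n = n} (λ _ → false) ≡ 0ᶠ
tabulate-false n = trans (tabulate-allFin _) (map-const _ false)

additive-zero-on-basis : ∀ {n m} (f : F2V n → F2V m) → Additive f → (∀ i → f (eᶠ i) ≡ 0ᶠ) →
  ∀ x → f x ≡ 0ᶠ
additive-zero-on-basis {zero} f f-additive _ [] = begin
  f []            ≡⟨ cong f (sym (⊕-same [])) ⟩
  f ([] ⊕ [])     ≡⟨ f-additive [] [] ⟩
  f [] ⊕ f []     ≡⟨ ⊕-same (f []) ⟩
  0ᶠ              ∎
  where open ≡-Reasoning
additive-zero-on-basis {suc n} f f-additive f-basis (b ∷ x) = begin
  f (b ∷ x)                         ≡⟨ cong f (cong₂ _∷_ (sym (xor-identityʳ b)) (sym (⊕-identityˡ x))) ⟩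
  f ((b ∷ 0ᶠ) ⊕ (false ∷ x))        ≡⟨ f-additive (b ∷ 0ᶠ) (false ∷ x) ⟩
  f (b ∷ 0ᶠ) ⊕ f (false ∷ x)        ≡⟨ cong₂ _⊕_ (head b) (tail x) ⟩
  0ᶠ ⊕ 0ᶠ                           ≡⟨ ⊕-same 0ᶠ ⟩
  0ᶠ                                ∎
  where
  open ≡-Reasoning
  tail : ∀ x → f (false ∷ x) ≡ 0ᶠ
  tail = additive-zero-on-basis (f ∘ (false ∷_)) (λ x y → f-additive (false ∷ x) (false ∷ y))
                                (f-basis ∘ Fin.suc)
  head : ∀ b → f (b ∷ 0ᶠ) ≡ 0ᶠ
  head false = tail 0ᶠ
  head true  = trans (cong (λ z → f (true ∷ z)) (sym (tabulate-false n))) (f-basis Fin.zero)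

Δ-unique-on-basis : ∀ {n m} (f g : F2V n → F2V m) → (∀ x y → Δ f x y ≡ Δ g x y) →
  (∀ i → f (eᶠ i) ≡ g (eᶠ i)) → f ≗ g
Δ-unique-on-basis f g Δf≡Δg f≡g-basis x =
  to ⊕≡0ᶠ⇔≡ (additive-zero-on-basis f⊕g f⊕g-additive (λ i → from ⊕≡0ᶠ⇔≡ (f≡g-basis i)) x)
  where
  f⊕g : F2V _ → F2V _
  f⊕g z = f z ⊕ g z
  f⊕g-additive : Additive f⊕g
  f⊕g-additive x y = to (Δ≡0ᶠ⇔additive f⊕g x y) (trans (Δ-⊕ f g x y) (from ⊕≡0ᶠ⇔≡ (Δf≡Δg x y)))

additive-unique-on-basis : ∀ {n m} (f g : F2V n → F2V m) → Additive f → Additive g →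
  (∀ i → f (eᶠ i) ≡ g (eᶠ i)) → f ≗ g
additive-unique-on-basis f g f-additive g-additive = Δ-unique-on-basis f g λ x y →
  trans (from (Δ≡0ᶠ⇔additive f x y) (f-additive x y)) (sym (from (Δ≡0ᶠ⇔additive g x y) (g-additive x y)))

all-Bool? : {P : Bool → Set} → (∀ b → Dec (P b)) → Dec (∀ b → P b)
all-Bool? P? = map′ (λ (p , q) → λ { false → p ; true → q }) (λ f → f false , f true) (P? false ×-dec P? true)

high₄ : ℤ₄ → Bool
high₄ Fin.zero                = false
high₄ (Fin.suc Fin.zero)      = false
high₄ (Fin.suc (Fin.suc _))   = true

low : ∀ {n} → Z4V n → F2V n
low = V.map mod2

high : ∀ {n} → Z4V n → F2V n
high = V.map high₄

low-⌊⌋ : ∀ {n} (a b : F2V n) → low ⌊ a , b ⌋ ≡ a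
low-⌊⌋ []       []       = refl
low-⌊⌋ (a ∷ as) (b ∷ bs) = cong₂ _∷_ (digit a b) (low-⌊⌋ as bs)
  where
  digit : ∀ a b → mod2 (ψ a +₄ (two *₄ ψ b)) ≡ a
  digit = toWitness {a? = all-Bool? λ a → all-Bool? λ b → _ B.≟ _} tt

high-⌊⌋ : ∀ {n} (a b : F2V n) → high ⌊ a , b ⌋ ≡ b
high-⌊⌋ []       []       = refl
high-⌊⌋ (a ∷ as) (b ∷ bs) = cong₂ _∷_ (digit a b) (high-⌊⌋ as bs)
  where
  digit : ∀ a b → high₄ (ψ a +₄ (two *₄ ψ b)) ≡ b
  digit = toWitness {a? = all-Bool? λ a → all-Bool? λ b → _ B.≟ _} tt

⌊low,high⌋ : ∀ {n} (v : Z4V n) → ⌊ low v , high v ⌋ ≡ v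
⌊low,high⌋ []      = refl
⌊low,high⌋ (a ∷ v) = cong₂ _∷_ (digits a) (⌊low,high⌋ v)
  where
  digits : ∀ a → ψ (mod2 a) +₄ (two *₄ ψ (high₄ a)) ≡ a
  digits = toWitness {a? = all? λ a → _ F.≟ _} tt

⌊⌋-injective : ∀ {n} {a b c d : F2V n} → ⌊ a , b ⌋ ≡ ⌊ c , d ⌋ → a ≡ c × b ≡ d
⌊⌋-injective {a = a} {b} {c} {d} e =
  trans (sym (low-⌊⌋ a b)) (trans (cong low e) (low-⌊⌋ c d)) ,
  trans (sym (high-⌊⌋ a b)) (trans (cong high e) (high-⌊⌋ c d))

low-Ψ : ∀ {n} (a : F2V n) → low (Ψ a) ≡ a
low-Ψ []          = refl
low-Ψ (false ∷ a) = cong (false ∷_) (low-Ψ a)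
low-Ψ (true ∷ a)  = cong (true ∷_) (low-Ψ a)

⌊⌋-+ᶻ : ∀ {n} (a b c d : F2V n) → ⌊ a , b ⌋ +ᶻ ⌊ c , d ⌋ ≡ ⌊ a ⊕ c , b ⊕ d ⊕ a ⊙ c ⌋
⌊⌋-+ᶻ []       []       []       []       = refl
⌊⌋-+ᶻ (a ∷ as) (b ∷ bs) (c ∷ cs) (d ∷ ds) = cong₂ _∷_ (carry a b c d) (⌊⌋-+ᶻ as bs cs ds)
  where
  carry : ∀ a b c d → (ψ a +₄ (two *₄ ψ b)) +₄ (ψ c +₄ (two *₄ ψ d))
                      ≡ ψ (a xor c) +₄ (two *₄ ψ ((b xor d) xor (a ∧ c)))
  carry = toWitness {a? = all-Bool? λ a → all-Bool? λ b → all-Bool? λ c → all-Bool? λ d → _ F.≟ _} tt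

Ψ-+ᶻ : ∀ {n} (a c : F2V n) → Ψ a +ᶻ Ψ c ≡ ⌊ a ⊕ c , a ⊙ c ⌋
Ψ-+ᶻ []       []       = refl
Ψ-+ᶻ (a ∷ as) (c ∷ cs) = cong₂ _∷_ (carry a c) (Ψ-+ᶻ as cs)
  where
  carry : ∀ a c → ψ a +₄ ψ c ≡ ψ (a xor c) +₄ (two *₄ ψ (a ∧ c))
  carry = toWitness {a? = all-Bool? λ a → all-Bool? λ c → _ F.≟ _} tt

⌊⌋-+ᶻ-⌊0ᶠ,c⌋ : ∀ {n} (a b c : F2V n) → ⌊ a , b ⌋ +ᶻ ⌊ 0ᶠ , c ⌋ ≡ ⌊ a , b ⊕ c ⌋
⌊⌋-+ᶻ-⌊0ᶠ,c⌋ []       []       []       = refl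
⌊⌋-+ᶻ-⌊0ᶠ,c⌋ (a ∷ as) (b ∷ bs) (c ∷ cs) = cong₂ _∷_ (add a b c) (⌊⌋-+ᶻ-⌊0ᶠ,c⌋ as bs cs)
  where
  add : ∀ a b c → (ψ a +₄ (two *₄ ψ b)) +₄ (ψ false +₄ (two *₄ ψ c)) ≡ ψ a +₄ (two *₄ ψ (b xor c))
  add = toWitness {a? = all-Bool? λ a → all-Bool? λ b → all-Bool? λ c → _ F.≟ _} tt

+ᶻ-self : ∀ {n} (v : Z4V n) → v +ᶻ v ≡ ⌊ 0ᶠ , low v ⌋
+ᶻ-self []      = refl
+ᶻ-self (a ∷ v) = cong₂ _∷_ (double a) (+ᶻ-self v)
  where
  double : ∀ a → a +₄ a ≡ ψ false +₄ (two *₄ ψ (mod2 a))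
  double = toWitness {a? = all? λ a → _ F.≟ _} tt

map-two*₄ : ∀ {n} (v : Z4V n) → V.map (two *₄_) v ≡ v +ᶻ v
map-two*₄ []      = refl
map-two*₄ (a ∷ v) = cong₂ _∷_ (double a) (map-two*₄ v)
  where
  double : ∀ a → two *₄ a ≡ a +₄ a
  double = toWitness {a? = all? λ a → _ F.≟ _} tt

dot : ∀ {n} → Vec ℤ₄ n → Z4V n → ℤ₄
dot row v = V.foldr (λ _ → ℤ₄) _+₄_ Fin.zero (V.zipWith _*₄_ row v)

dot-+ᶻ : ∀ {n} (row u w : Z4V n) → dot row (u +ᶻ w) ≡ dot row u +₄ dot row w
dot-+ᶻ []        []      []      = refl
dot-+ᶻ (r ∷ row) (a ∷ u) (b ∷ w) =
  trans (cong₂ _+₄_ (*₄-distribˡ-+₄ r a b) (dot-+ᶻ row u w))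
        (+₄-interchange (r *₄ a) (r *₄ b) (dot row u) (dot row w))
  where
  *₄-distribˡ-+₄ : ∀ r a b → r *₄ (a +₄ b) ≡ (r *₄ a) +₄ (r *₄ b)
  *₄-distribˡ-+₄ = toWitness {a? = all? λ r → all? λ a → all? λ b → _ F.≟ _} tt
  +₄-interchange : ∀ a b c d → (a +₄ b) +₄ (c +₄ d) ≡ (a +₄ c) +₄ (b +₄ d)
  +₄-interchange = toWitness {a? = all? λ a → all? λ b → all? λ c → all? λ d → _ F.≟ _} tt

ρ-+ᶻ : ∀ {n} (L : Mat4 n) (u w : Z4V n) → ρ L (u +ᶻ w) ≡ ρ L u +ᶻ ρ L w
ρ-+ᶻ L u w = rows L
  where
  rows : ∀ {m} (L : Vec (Vec ℤ₄ _) m) →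
         V.map (λ row → dot row (u +ᶻ w)) L ≡ V.map (λ row → dot row u) L +ᶻ V.map (λ row → dot row w) L
  rows []        = refl
  rows (row ∷ L) = cong₂ _∷_ (dot-+ᶻ row u w) (rows L)

mod2-dot : ∀ {n} (row v : Z4V n) →
  mod2 (dot row v) ≡ V.foldr (λ _ → Bool) _xor_ false (V.zipWith _∧_ (V.map mod2 row) (low v))
mod2-dot []        []      = refl
mod2-dot (r ∷ row) (a ∷ v) = trans (mod2-+₄ (r *₄ a) (dot row v)) (cong₂ _xor_ (mod2-*₄ r a) (mod2-dot row v))
  where
  mod2-+₄ : ∀ a b → mod2 (a +₄ b) ≡ mod2 a xor mod2 b
  mod2-+₄ = toWitness {a? = all? λ a → all? λ b → _ B.≟ _} tt
  mod2-*₄ : ∀ a b → mod2 (a *₄ b) ≡ mod2 a ∧ mod2 b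
  mod2-*₄ = toWitness {a? = all? λ a → all? λ b → _ B.≟ _} tt

low-ρ : ∀ {n} (L : Mat4 n) (v : Z4V n) → low (ρ L v) ≡ applyMod2 L (low v)
low-ρ L v = trans (sym (map-∘ mod2 (λ row → dot row v) L)) (map-cong (λ row → mod2-dot row v) L)

*₄ψfalse-+₄ : ∀ r a → (r *₄ ψ false) +₄ a ≡ a
*₄ψfalse-+₄ = toWitness {a? = all? λ r → all? λ a → _ F.≟ _} tt

dot-Ψ0ᶠ : ∀ {n} (row : Z4V n) → dot row (Ψ 0ᶠ) ≡ Fin.zero
dot-Ψ0ᶠ []        = refl
dot-Ψ0ᶠ (r ∷ row) = trans (cong ((r *₄ ψ false) +₄_) (dot-Ψ0ᶠ row)) (*₄ψfalse-+₄ r Fin.zero)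

dot-Ψeᶠ : ∀ {n} (f : Fin n → ℤ₄) (j : Fin n) → dot (tabulate f) (Ψ (eᶠ j)) ≡ f j
dot-Ψeᶠ {suc n} f Fin.zero = begin
  (r *₄ ψ true) +₄ dot f′ (Ψ (tabulate (λ _ → false)))
    ≡⟨ cong (λ z → (r *₄ ψ true) +₄ dot f′ (Ψ z)) (tabulate-false n) ⟩
  (r *₄ ψ true) +₄ dot f′ (Ψ 0ᶠ)  ≡⟨ cong ((r *₄ ψ true) +₄_) (dot-Ψ0ᶠ f′) ⟩
  (r *₄ ψ true) +₄ Fin.zero       ≡⟨ *₄ψtrue-+₄0 r ⟩
  r                               ∎
  where
  open ≡-Reasoning
  r : ℤ₄
  r = f Fin.zero
  f′ : Z4V n
  f′ = tabulate (f ∘ Fin.suc)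
  *₄ψtrue-+₄0 : ∀ r → (r *₄ ψ true) +₄ Fin.zero ≡ r
  *₄ψtrue-+₄0 = toWitness {a? = all? λ r → _ F.≟ _} tt
dot-Ψeᶠ f (Fin.suc j) = trans (*₄ψfalse-+₄ (f Fin.zero) _) (dot-Ψeᶠ (λ i → f (Fin.suc i)) j)

fromColumns : ∀ {n} → (Fin n → Z4V n) → Mat4 n
fromColumns c = tabulate λ r → tabulate λ i → lookup (c i) r

ρ-fromColumns : ∀ {n} (c : Fin n → Z4V n) (j : Fin n) → ρ (fromColumns c) (Ψ (eᶠ j)) ≡ c j
ρ-fromColumns c j = begin
  ρ (fromColumns c) (Ψ (eᶠ j))
    ≡⟨ sym (tabulate-∘ (λ row → dot row (Ψ (eᶠ j))) _) ⟩
  tabulate (λ r → dot (tabulate λ i → lookup (c i) r) (Ψ (eᶠ j)))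
    ≡⟨ tabulate-cong (λ r → dot-Ψeᶠ (λ i → lookup (c i) r) j) ⟩
  tabulate (lookup (c j))
    ≡⟨ tabulate∘lookup (c j) ⟩
  c j ∎
  where open ≡-Reasoning

ρΨ-high : ∀ {n} → Mat4 n → F2V n → F2V n
ρΨ-high L a = high (ρ L (Ψ a))

low-ρΨ : ∀ {n} (L : Mat4 n) (a : F2V n) → low (ρ L (Ψ a)) ≡ applyMod2 L a
low-ρΨ L a = trans (low-ρ L (Ψ a)) (cong (applyMod2 L) (low-Ψ a))

ρ-Ψ : ∀ {n} (L : Mat4 n) (a : F2V n) → ρ L (Ψ a) ≡ ⌊ applyMod2 L a , ρΨ-high L a ⌋
ρ-Ψ L a = begin
  ρ L (Ψ a)                                       ≡⟨ sym (⌊low,high⌋ (ρ L (Ψ a))) ⟩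
  ⌊ low (ρ L (Ψ a)) , ρΨ-high L a ⌋               ≡⟨ cong ⌊_, ρΨ-high L a ⌋ (low-ρΨ L a) ⟩
  ⌊ applyMod2 L a , ρΨ-high L a ⌋                 ∎
  where open ≡-Reasoning

ρ-⌊⌋ : ∀ {n} (L : Mat4 n) (a b : F2V n) → ρ L ⌊ a , b ⌋ ≡ ⌊ applyMod2 L a , ρΨ-high L a ⊕ applyMod2 L b ⌋
ρ-⌊⌋ L a b = begin
  ρ L (Ψ a +ᶻ V.map (two *₄_) (Ψ b))              ≡⟨ cong (λ z → ρ L (Ψ a +ᶻ z)) (map-two*₄ (Ψ b)) ⟩
  ρ L (Ψ a +ᶻ (Ψ b +ᶻ Ψ b))                       ≡⟨ ρ-+ᶻ L (Ψ a) (Ψ b +ᶻ Ψ b) ⟩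
  ρ L (Ψ a) +ᶻ ρ L (Ψ b +ᶻ Ψ b)                   ≡⟨ cong₂ _+ᶻ_ (ρ-Ψ L a) (ρ-+ᶻ L (Ψ b) (Ψ b)) ⟩
  ⌊ applyMod2 L a , ρΨ-high L a ⌋ +ᶻ (ρ L (Ψ b) +ᶻ ρ L (Ψ b))
    ≡⟨ cong (⌊ applyMod2 L a , ρΨ-high L a ⌋ +ᶻ_) (+ᶻ-self (ρ L (Ψ b))) ⟩
  ⌊ applyMod2 L a , ρΨ-high L a ⌋ +ᶻ ⌊ 0ᶠ , low (ρ L (Ψ b)) ⌋
    ≡⟨ cong (λ z → ⌊ applyMod2 L a , ρΨ-high L a ⌋ +ᶻ ⌊ 0ᶠ , z ⌋) (low-ρΨ L b) ⟩
  ⌊ applyMod2 L a , ρΨ-high L a ⌋ +ᶻ ⌊ 0ᶠ , applyMod2 L b ⌋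
    ≡⟨ ⌊⌋-+ᶻ-⌊0ᶠ,c⌋ _ _ _ ⟩
  ⌊ applyMod2 L a , ρΨ-high L a ⊕ applyMod2 L b ⌋ ∎
  where open ≡-Reasoning

-- ρ(L) (Ψ x + Ψ y), computed through additivity of ρ(L) and through the carry Ψ x + Ψ y = ⌊ x ⊕ y , x ⊙ y ⌋;
-- its two digit components give additivity of L mod 2 and the polarization of ρΨ-high L.
ρΨ-+ᶻ : ∀ {n} (L : Mat4 n) (x y : F2V n) →
  ⌊ applyMod2 L x ⊕ applyMod2 L y , ρΨ-high L x ⊕ ρΨ-high L y ⊕ applyMod2 L x ⊙ applyMod2 L y ⌋
  ≡ ⌊ applyMod2 L (x ⊕ y) , ρΨ-high L (x ⊕ y) ⊕ applyMod2 L (x ⊙ y) ⌋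
ρΨ-+ᶻ L x y = begin
  ⌊ applyMod2 L x ⊕ applyMod2 L y , ρΨ-high L x ⊕ ρΨ-high L y ⊕ applyMod2 L x ⊙ applyMod2 L y ⌋
    ≡⟨ sym (⌊⌋-+ᶻ _ _ _ _) ⟩
  ⌊ applyMod2 L x , ρΨ-high L x ⌋ +ᶻ ⌊ applyMod2 L y , ρΨ-high L y ⌋
    ≡⟨ sym (cong₂ _+ᶻ_ (ρ-Ψ L x) (ρ-Ψ L y)) ⟩
  ρ L (Ψ x) +ᶻ ρ L (Ψ y)  ≡⟨ sym (ρ-+ᶻ L (Ψ x) (Ψ y)) ⟩
  ρ L (Ψ x +ᶻ Ψ y)        ≡⟨ cong (ρ L) (Ψ-+ᶻ x y) ⟩
  ρ L ⌊ x ⊕ y , x ⊙ y ⌋   ≡⟨ ρ-⌊⌋ L (x ⊕ y) (x ⊙ y) ⟩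
  ⌊ applyMod2 L (x ⊕ y) , ρΨ-high L (x ⊕ y) ⊕ applyMod2 L (x ⊙ y) ⌋ ∎
  where open ≡-Reasoning

applyMod2-additive : ∀ {n} (L : Mat4 n) → Additive (applyMod2 L)
applyMod2-additive L x y = sym (proj₁ (⌊⌋-injective (ρΨ-+ᶻ L x y)))

Δ-ρΨ-high : ∀ {n} (L : Mat4 n) (x y : F2V n) →
  Δ (ρΨ-high L) x y ≡ applyMod2 L x ⊙ applyMod2 L y ⊕ applyMod2 L (x ⊙ y)
Δ-ρΨ-high L x y = trans (trans (⊕-assoc (q (x ⊕ y)) (q x) (q y)) (⊕-comm (q (x ⊕ y)) (q x ⊕ q y)))
                        (to ⊕-swap-≡ (proj₂ (⌊⌋-injective (ρΨ-+ᶻ L x y))))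
  where
  q = ρΨ-high L

graph-image⇔ : ∀ {n} {D₁ D₂ : List (Z4V n)} {h₁ h₂ M k : F2V n → F2V n} (f : Z4V n → Z4V n) →
  IsRepresentation D₁ h₁ → IsRepresentation D₂ h₂ → IsInvertible M →
  (∀ d → f ⌊ d , h₁ d ⌋ ≡ ⌊ M d , k d ⌋) →
  SameSet D₂ (map f D₁) ⇔ (∀ d → h₂ (M d) ≡ k d)
graph-image⇔ {D₁ = D₁} {D₂} {h₁} {h₂} {M} {k} f rep₁ rep₂ (M′ , M′M , MM′) f-graph = mk⇔ image⇒ ⇒image
  where
  M-injective : ∀ {d d′} → M d ≡ M d′ → d ≡ d′
  M-injective {d} {d′} e = trans (sym (M′M d)) (trans (cong M′ e) (M′M d′))

  image⇒ : SameSet D₂ (map f D₁) → ∀ d → h₂ (M d) ≡ k d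
  image⇒ same d with ∈-map⁻ f (to (same _) (from (rep₂ _) (M d , refl)))
  ... | w , w∈D₁ , e with to (rep₁ w) w∈D₁
  ... | d′ , refl with ⌊⌋-injective (trans e (f-graph d′))
  ... | Md≡Md′ , h₂Md≡kd′ = trans h₂Md≡kd′ (cong k (sym (M-injective Md≡Md′)))

  ⇒image : (∀ d → h₂ (M d) ≡ k d) → SameSet D₂ (map f D₁)
  ⇒image h₂M≡k v = mk⇔ D₂⊆ ⊆D₂
    where
    D₂⊆ : v ∈ D₂ → v ∈ map f D₁
    D₂⊆ v∈D₂ with to (rep₂ v) v∈D₂
    ... | d , refl = subst (_∈ map f D₁) image≡v (∈-map⁺ f (from (rep₁ _) (M′ d , refl)))
      where
      image≡v : f ⌊ M′ d , h₁ (M′ d) ⌋ ≡ ⌊ d , h₂ d ⌋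
      image≡v = trans (f-graph (M′ d)) (trans (cong (⌊ M (M′ d) ,_⌋) (sym (h₂M≡k (M′ d))))
                                              (cong (λ z → ⌊ z , h₂ z ⌋) (MM′ d)))
    ⊆D₂ : v ∈ map f D₁ → v ∈ D₂
    ⊆D₂ v∈fD₁ with ∈-map⁻ f v∈fD₁
    ... | w , w∈D₁ , e with to (rep₁ w) w∈D₁
    ... | d′ , refl = from (rep₂ v) (M d′ , trans e (trans (f-graph d′) (cong (⌊ M d′ ,_⌋) (sym (h₂M≡k d′)))))

_IsLiftOf_ : ∀ {n} → Mat4 n → (F2V n → F2V n) → Set
L IsLiftOf M = applyMod2 L ≗ M

Δ-ρΨ-high-lift : ∀ {n} {L : Mat4 n} {M : F2V n → F2V n} → L IsLiftOf M → ∀ x y →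
  Δ (ρΨ-high L) x y ≡ M x ⊙ M y ⊕ M (x ⊙ y)
Δ-ρΨ-high-lift {L = L} L≡M x y =
  trans (Δ-ρΨ-high L x y) (cong₂ _⊕_ (cong₂ _⊙_ (L≡M x) (L≡M y)) (L≡M (x ⊙ y)))

lift-with-highs-on-basis : ∀ {n} {M : F2V n → F2V n} → Additive M → (c : F2V n → F2V n) →
  ∃[ L ] (L IsLiftOf M × (∀ i → ρΨ-high L (eᶠ i) ≡ c (eᶠ i)))
lift-with-highs-on-basis {M = M} M-additive c = L , L≡M , proj₂ ∘ column-digits
  where
  column : Fin _ → Z4V _
  column i = ⌊ M (eᶠ i) , c (eᶠ i) ⌋
  L : Mat4 _
  L = fromColumns column
  column-digits : ∀ i → applyMod2 L (eᶠ i) ≡ M (eᶠ i) × ρΨ-high L (eᶠ i) ≡ c (eᶠ i)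
  column-digits i = ⌊⌋-injective (trans (sym (ρ-Ψ L (eᶠ i))) (ρ-fromColumns column i))
  L≡M : L IsLiftOf M
  L≡M = additive-unique-on-basis (applyMod2 L) M (applyMod2-additive L) M-additive (proj₁ ∘ column-digits)

mismatch : ∀ {n} → (h₁ h₂ M : F2V n → F2V n) → F2V n → F2V n
mismatch h₁ h₂ M d = h₂ (M d) ⊕ M (h₁ d)

ρ-image⇔ : ∀ {n} {D₁ D₂ : List (Z4V n)} {h₁ h₂ M : F2V n → F2V n} {L : Mat4 n} →
  IsRepresentation D₁ h₁ → IsRepresentation D₂ h₂ → IsInvertible M → L IsLiftOf M →
  SameSet D₂ (map (ρ L) D₁) ⇔ (mismatch h₁ h₂ M ≗ ρΨ-high L)
ρ-image⇔ {h₁ = h₁} {L = L} rep₁ rep₂ M-invertible L≡M =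
  ⇔-trans (graph-image⇔ (ρ L) rep₁ rep₂ M-invertible graph)
          (mk⇔ (λ e d → from ⊕-transpose (e d)) (λ e d → to ⊕-transpose (e d)))
  where
  graph : ∀ d → ρ L ⌊ d , h₁ d ⌋ ≡ ⌊ _ , ρΨ-high L d ⊕ _ ⌋
  graph d = trans (ρ-⌊⌋ L d (h₁ d)) (cong₂ (λ a b → ⌊ a , ρΨ-high L d ⊕ b ⌋) (L≡M d) (L≡M (h₁ d)))

star-compatible⇔ : ∀ {n} {L : Mat4 n} (h₁ h₂ M : F2V n → F2V n) → Additive M → L IsLiftOf M → ∀ x y →
  (star h₂ (M x) (M y) ≡ M (star h₁ x y)) ⇔ (Δ (mismatch h₁ h₂ M) x y ≡ Δ (ρΨ-high L) x y)
star-compatible⇔ h₁ h₂ M M-additive L≡M x y =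
  ⇔-trans (≡-resp-⇔ star₂ star₁)
    (⇔-trans ⊕-swap-≡ (≡-resp-⇔ (sym (Δ-⊕ _ _ x y)) (sym (Δ-ρΨ-high-lift L≡M x y))))
  where
  star₂ : star h₂ (M x) (M y) ≡ Δ (h₂ ∘ M) x y ⊕ M x ⊙ M y
  star₂ = cong (λ z → h₂ z ⊕ h₂ (M x) ⊕ h₂ (M y) ⊕ M x ⊙ M y) (sym (M-additive x y))
  star₁ : M (star h₁ x y) ≡ Δ (M ∘ h₁) x y ⊕ M (x ⊙ y)
  star₁ = trans (M-additive _ _) (cong (_⊕ M (x ⊙ y)) (Δ-∘-additive M M-additive h₁ x y))

theorem2p3 : (n : ℕ) (D₁ D₂ : List (Z4V n)) (h₁ h₂ : F2V n → F2V n)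
    → IsRDS4 n D₁ → IsRDS4 n D₂
    → IsRepresentation D₁ h₁ → IsRepresentation D₂ h₂
    → Normalized h₁ → Normalized h₂
    → (M : F2V n → F2V n) → IsF2Linear M → IsInvertible M
    → (∃[ L ] ((∀ x → applyMod2 L x ≡ M x) × SameSet D₂ (map (ρ L) D₁)))
      ⇔ (∀ x y → star h₂ (M x) (M y) ≡ M (star h₁ x y))
theorem2p3 n D₁ D₂ h₁ h₂ _ _ rep₁ rep₂ _ _ M M-additive M-invertible = mk⇔ lift⇒compatible compatible⇒lift
  where
  Compatible : Set
  Compatible = ∀ x y → star h₂ (M x) (M y) ≡ M (star h₁ x y)

  lift⇒compatible : ∃[ L ] (L IsLiftOf M × SameSet D₂ (map (ρ L) D₁)) → Compatible
  lift⇒compatible (L , L≡M , same) x y = from (star-compatible⇔ h₁ h₂ M M-additive L≡M x y)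
    (Δ-cong (to (ρ-image⇔ rep₁ rep₂ M-invertible L≡M) same) x y)

  compatible⇒lift : Compatible → ∃[ L ] (L IsLiftOf M × SameSet D₂ (map (ρ L) D₁))
  compatible⇒lift compatible with lift-with-highs-on-basis M-additive (mismatch h₁ h₂ M)
  ... | L , L≡M , highs = L , L≡M , from (ρ-image⇔ rep₁ rep₂ M-invertible L≡M)
    (Δ-unique-on-basis _ _ (λ x y → to (star-compatible⇔ h₁ h₂ M M-additive L≡M x y) (compatible x y))
                           (sym ∘ highs))
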